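{- For every positive integer $n$, \[ \sum_{k=0}^{n-1}\frac{\mathbb{F}_{k}}{k+1}=\frac{{n+1 \brack 2}}{n!}\,\mathbb{F}_{n}-\sum_{k=0}^{n-1}\frac{{k+2 \brack 2}}{(k+1)!\,F_{k+1}}. \]
   Context: $F_n$ denotes the Fibonacci numbers: $F_0=0$, $F_1=1$, $F_{n+2}=F_{n+1}+F_n$. The $n$-th harmonic Fibonacci number is $\mathbb{F}_{n}=\sum_{k=1}^{n}\frac{1}{F_{k}}$ for $n\ge 1$, with $\mathbb{F}_0=0$. ${n \brack k}$ denotes the (unsigned) Stirling number of the first kind, the number of permutations of $n$ elements with exactly $k$ disjoint cycles. -}

module Defs where

open import Data.Nat as ℕ using (ℕ; zero; suc; NonZero)
open import Data.Nat using (_!)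
open import Data.Nat.Properties using (_!≢0)
open import Data.Integer using (+_)
open import Data.Rational using (ℚ; _/_; _+_; _-_; _*_; 0ℚ)

fib : ℕ → ℕ
fib zero = zero
fib (suc zero) = suc zero
fib (suc (suc n)) = fib (suc n) ℕ.+ fib n

fib-suc-nonZero : ∀ k → NonZero (fib (suc k))
fib-suc-nonZero zero = _
fib-suc-nonZero (suc zero) = _
fib-suc-nonZero (suc (suc k)) with fib (suc (suc k)) | fib-suc-nonZero (suc k)
... | suc m | _ = _

invFibSuc : ℕ → ℚ
invFibSuc k = (+ 1) / fib (suc k)
  where instance _ = fib-suc-nonZero k

-- harmonic Fibonacci number: 𝔽 n = Σ_{k=1}^{n} 1 / F k, 𝔽 0 = 0
harmFib : ℕ → ℚ
harmFib zero = 0ℚ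
harmFib (suc n) = harmFib n + invFibSuc n

stirling1 : ℕ → ℕ → ℕ
stirling1 zero zero = 1
stirling1 zero (suc k) = 0
stirling1 (suc n) zero = 0
stirling1 (suc n) (suc k) = n ℕ.* stirling1 n (suc k) ℕ.+ stirling1 n k

sumTo : ℕ → (ℕ → ℚ) → ℚ
sumTo zero f = 0ℚ
sumTo (suc n) f = sumTo n f + f n

toℚ : ℕ → ℚ
toℚ n = (+ n) / 1

overFact : ℕ → ℕ → ℚ
overFact a m = (+ a) / (m !)
  where instance _ = m !≢0

{-# OPTIONS --safe #-}
module Submission where

-- [n+1 2] / n! is the harmonic number H n, since [n+1 1] = n! turns the Stirling
-- recurrence into H (n+1) = H n + 1/(n+1). The identity is then summation by parts
-- applied to the partial sums H of 1/(k+1) and 𝔽 of 1/F(k+1).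

open import Defs
open import Data.Nat as ℕ using (ℕ; suc; zero; _≥_; NonZero; _!)
open import Data.Integer using (+_)
open import Data.Rational using (ℚ; _/_; _+_; _-_; _*_; toℚᵘ)
open import Relation.Binary.PropositionalEquality
import Data.Integer as ℤ
import Data.Integer.Properties as ℤ
import Data.Nat.Properties as ℕ
import Data.Rational.Properties as ℚ
import Data.Rational.Unnormalised as ℚᵘ
import Data.Rational.Unnormalised.Properties as ℚᵘ
open import Data.Nat.Tactic.RingSolver using (solve-∀)
open import Data.Rational.Solver using (module +-*-Solver)

/-sum-byCrossMultiplication : ∀ a b c d e f .{{_ : NonZero b}} .{{_ : NonZero d}} .{{_ : NonZero f}} →
  a ℕ.* (d ℕ.* f) ≡ (c ℕ.* f ℕ.+ e ℕ.* d) ℕ.* b →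
  (+ a) / b ≡ (+ c) / d + (+ e) / f
/-sum-byCrossMultiplication a b@(suc b-1) c d@(suc d-1) e f@(suc f-1) eq = ℚ.toℚᵘ-injective (begin
    toℚᵘ ((+ a) / b)                                ≈⟨ ℚ.toℚᵘ-fromℚᵘ (ℚᵘ.mkℚᵘ (+ a) b-1) ⟩
    ℚᵘ.mkℚᵘ (+ a) b-1                               ≈⟨ ℚᵘ.*≡* crossMultiplied ⟩
    ℚᵘ.mkℚᵘ (+ c) d-1 ℚᵘ.+ ℚᵘ.mkℚᵘ (+ e) f-1         ≈⟨ ℚᵘ.+-cong (ℚ.toℚᵘ-fromℚᵘ (ℚᵘ.mkℚᵘ (+ c) d-1)) (ℚ.toℚᵘ-fromℚᵘ (ℚᵘ.mkℚᵘ (+ e) f-1)) ⟨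
    toℚᵘ ((+ c) / d) ℚᵘ.+ toℚᵘ ((+ e) / f)          ≈⟨ ℚᵘ.≃-sym (ℚ.toℚᵘ-homo-+ ((+ c) / d) ((+ e) / f)) ⟩
    toℚᵘ ((+ c) / d + (+ e) / f)                    ∎)
  where
  open import Relation.Binary.Reasoning.Setoid ℚᵘ.≃-setoid
  crossMultiplied : + a ℤ.* + (d ℕ.* f) ≡ (+ c ℤ.* + f ℤ.+ + e ℤ.* + d) ℤ.* + b
  crossMultiplied =
    trans (sym (ℤ.pos-* a (d ℕ.* f))) (trans (cong +_ eq) (trans (ℤ.pos-* (c ℕ.* f ℕ.+ e ℕ.* d) b)
      (cong (ℤ._* + b) (trans (ℤ.pos-+ (c ℕ.* f) (e ℕ.* d)) (cong₂ ℤ._+_ (ℤ.pos-* c f) (ℤ.pos-* e d))))))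

stirling1-suc-1 : ∀ n → stirling1 (suc n) 1 ≡ n !
stirling1-suc-1 zero    = refl
stirling1-suc-1 (suc n) = begin
  suc n ℕ.* stirling1 (suc n) 1 ℕ.+ 0  ≡⟨ ℕ.+-identityʳ _ ⟩
  suc n ℕ.* stirling1 (suc n) 1        ≡⟨ cong (suc n ℕ.*_) (stirling1-suc-1 n) ⟩
  suc n ℕ.* n !                        ∎
  where open ≡-Reasoning

harmonic : ℕ → ℚ
harmonic n = sumTo n (λ k → (+ 1) / suc k)

stirling1-2/factorial≡harmonic : ∀ n → overFact (stirling1 (suc n) 2) n ≡ harmonic n
stirling1-2/factorial≡harmonic zero    = refl
stirling1-2/factorial≡harmonic (suc n) = begin
  (+ (suc n ℕ.* s ℕ.+ stirling1 (suc n) 1)) / (suc n !)  ≡⟨ fractionStep ⟩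
  (+ s) / (n !) + (+ 1) / suc n                         ≡⟨ cong (_+ (+ 1) / suc n) (stirling1-2/factorial≡harmonic n) ⟩
  harmonic n + (+ 1) / suc n                            ∎
  where
  open ≡-Reasoning
  s : ℕ
  s = stirling1 (suc n) 2
  instance _ = suc n ℕ.!≢0
  instance _ = n ℕ.!≢0
  denominatorsCleared : ∀ n s f → (suc n ℕ.* s ℕ.+ f) ℕ.* (f ℕ.* suc n)
                                ≡ (s ℕ.* suc n ℕ.+ 1 ℕ.* f) ℕ.* (suc n ℕ.* f)
  denominatorsCleared = solve-∀
  fractionStep : (+ (suc n ℕ.* s ℕ.+ stirling1 (suc n) 1)) / (suc n !) ≡ (+ s) / (n !) + (+ 1) / suc n
  fractionStep = /-sum-byCrossMultiplication (suc n ℕ.* s ℕ.+ stirling1 (suc n) 1) (suc n !) s (n !) 1 (suc n)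
    (subst (λ f → (suc n ℕ.* s ℕ.+ f) ℕ.* (n ! ℕ.* suc n) ≡ (s ℕ.* suc n ℕ.+ 1 ℕ.* n !) ℕ.* (suc n ℕ.* n !))
      (sym (stirling1-suc-1 n)) (denominatorsCleared n s (n !)))

sumTo-cong : ∀ n {f g : ℕ → ℚ} → (∀ k → f k ≡ g k) → sumTo n f ≡ sumTo n g
sumTo-cong zero    f≗g = refl
sumTo-cong (suc n) f≗g = cong₂ _+_ (sumTo-cong n f≗g) (f≗g n)

harmFib≡sumTo : ∀ n → harmFib n ≡ sumTo n invFibSuc
harmFib≡sumTo zero    = refl
harmFib≡sumTo (suc n) = cong (_+ invFibSuc n) (harmFib≡sumTo n)

sumTo-byParts : ∀ (a b : ℕ → ℚ) n →
  sumTo n (λ k → sumTo k a * b k)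
    ≡ sumTo n b * sumTo n a - sumTo n (λ k → sumTo (suc k) b * a k)
sumTo-byParts a b zero    = refl
sumTo-byParts a b (suc n) = begin
  sumTo n (λ k → sumTo k a * b k) + A * b n
    ≡⟨ cong (_+ A * b n) (sumTo-byParts a b n) ⟩
  (B * A - S) + A * b n
    ≡⟨ summationStep B A S (b n) (a n) ⟩
  (B + b n) * (A + a n) - (S + (B + b n) * a n)
    ∎
  where
  open ≡-Reasoning
  A B S : ℚ
  A = sumTo n a
  B = sumTo n b
  S = sumTo n (λ k → sumTo (suc k) b * a k)
  summationStep : ∀ B A S β α → (B * A - S) + A * β ≡ (B + β) * (A + α) - (S + (B + β) * α)
  summationStep = solve 5 (λ B A S β α → (B :* A :- S) :+ A :* β := (B :+ β) :* (A :+ α) :- (S :+ (B :+ β) :* α)) refl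
    where open +-*-Solver

mainTheorem6 : ∀ (n : ℕ) → n ≥ 1 →
    sumTo n (λ k → harmFib k * ((+ 1) / suc k))
      ≡ overFact (stirling1 (suc n) 2) n * harmFib n
        - sumTo n (λ k → overFact (stirling1 (k ℕ.+ 2) 2) (suc k) * invFibSuc k)
mainTheorem6 n _ = begin
  sumTo n (λ k → harmFib k * ((+ 1) / suc k))
    ≡⟨ sumTo-cong n (λ k → cong (_* ((+ 1) / suc k)) (harmFib≡sumTo k)) ⟩
  sumTo n (λ k → sumTo k invFibSuc * ((+ 1) / suc k))
    ≡⟨ sumTo-byParts invFibSuc (λ k → (+ 1) / suc k) n ⟩
  harmonic n * sumTo n invFibSuc - correction
    ≡⟨ cong₂ (λ x y → x * y - correction) (sym (stirling1-2/factorial≡harmonic n)) (sym (harmFib≡sumTo n)) ⟩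
  overFact (stirling1 (suc n) 2) n * harmFib n - correction
    ≡⟨ cong (overFact (stirling1 (suc n) 2) n * harmFib n -_) (sumTo-cong n stirlingTerm) ⟩
  overFact (stirling1 (suc n) 2) n * harmFib n
    - sumTo n (λ k → overFact (stirling1 (k ℕ.+ 2) 2) (suc k) * invFibSuc k)
    ∎
  where
  open ≡-Reasoning
  correction : ℚ
  correction = sumTo n (λ k → harmonic (suc k) * invFibSuc k)
  stirlingTerm : ∀ k → harmonic (suc k) * invFibSuc k ≡ overFact (stirling1 (k ℕ.+ 2) 2) (suc k) * invFibSuc k
  stirlingTerm k = cong (_* invFibSuc k) (begin
    harmonic (suc k)                          ≡⟨ stirling1-2/factorial≡harmonic (suc k) ⟨
    overFact (stirling1 (2 ℕ.+ k) 2) (suc k)  ≡⟨ cong (λ m → overFact (stirling1 m 2) (suc k)) (ℕ.+-comm 2 k) ⟩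
    overFact (stirling1 (k ℕ.+ 2) 2) (suc k)  ∎)
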